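{- Let $(G,A)$ be an edge-weighted graph, let $(G',A')$ be the result of an edge-collapse operation, and let $w,u$ be distinct vertices of $G$. Let $\mathcal{P}$ be the set of paths from $w$ to $u$ in $G$ and $\mathcal{Q}$ the set of paths from $w$ to $u$ in $G'$. Then $[\mathcal{P}]=[\mathcal{Q}]$.
   Context: An edge-weighted graph $(G,A)$ is a finite loopless graph (multiple edges allowed) with a weight function $A$ from its edges to positive integers. Edge collapse: if edges $e_1,\dots,e_r$ ($r\ge2$) all join the same pair of vertices and have weights $a_1,\dots,a_r$, replace them by a single edge joining that pair of weight $\operatorname{lcm}(a_1,\dots,a_r)$, leaving everything else unchanged. A path from $w$ to $u$ is a sequence of distinct vertices $w=y_0,\dots,y_k=u$ together with a choice, for each $t$, of an edge joining $y_{t-1}$ and $y_t$ (so paths using different parallel edges are different). For a path $p$, $(p)$ denotes the gcd of the weights of its edges; for a set $\mathcal{P}$ of paths, $[\mathcal{P}]$ denotes the lcm of the numbers $(p)$, $p\in\mathcal{P}$. -}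

module Defs where

open import Data.Nat using (ℕ; _<_; _≤_; zero; suc)
open import Data.Nat.GCD using (gcd)
open import Data.Nat.LCM using (lcm)
open import Data.Nat.Divisibility using (_∣_)
open import Data.Fin using (Fin)
open import Data.List using (List; []; _∷_; map; foldr; length; lookup; _++_)
open import Data.List.Relation.Unary.All using (All)
open import Data.List.Relation.Unary.Unique.Propositional using (Unique)
open import Data.List.Relation.Binary.Permutation.Propositional using (_↭_)
open import Data.Product using (Σ; _×_; _,_; proj₁; proj₂; ∃; ∃-syntax)
open import Data.Sum using (_⊎_)
open import Relation.Binary.PropositionalEquality using (_≡_; _≢_)

Edge : ℕ → Set
Edge n = Fin n × Fin n × ℕ

end₁ : ∀ {n} → Edge n → Fin n
end₁ (a , b , w) = a

end₂ : ∀ {n} → Edge n → Fin n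
end₂ (a , b , w) = b

weight : ∀ {n} → Edge n → ℕ
weight (a , b , w) = w

record Graph (n : ℕ) : Set where
  field
    edges    : List (Edge n)
    loopless : All (λ e → end₁ e ≢ end₂ e) edges
    positive : All (λ e → 0 < weight e) edges

open Graph public

EdgeIx : ∀ {n} → Graph n → Set
EdgeIx G = Fin (length (edges G))

edgeAt : ∀ {n} (G : Graph n) → EdgeIx G → Edge n
edgeAt G i = lookup (edges G) i

Joins : ∀ {n} → Edge n → Fin n → Fin n → Set
Joins e x y = (end₁ e ≡ x × end₂ e ≡ y) ⊎ (end₁ e ≡ y × end₂ e ≡ x)

lcmList : List ℕ → ℕ
lcmList = foldr lcm 1

gcdList : List ℕ → ℕ
gcdList = foldr gcd 0

-- G' arises from G by one edge collapse: edges S (r ≥ 2 of them) all joining x and y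
-- are replaced by a single edge joining x and y of weight lcm of their weights;
-- all other edges (rest) are unchanged (edge lists are taken up to reordering).
EdgeCollapse : ∀ {n} → Graph n → Graph n → Set
EdgeCollapse {n} G G' =
  Σ (Fin n) λ x → Σ (Fin n) λ y → Σ (List (Edge n)) λ S → Σ (List (Edge n)) λ rest →
    (edges G ↭ (S ++ rest)) × (2 ≤ length S) × All (λ e → Joins e x y) S ×
    (edges G' ↭ ((x , y , lcmList (map weight S)) ∷ rest))

data Walk {n} (G : Graph n) : Fin n → Fin n → Set where
  [] : ∀ {x} → Walk G x x
  step : ∀ {x y z} (i : EdgeIx G) → Joins (edgeAt G i) x y → Walk G y z → Walk G x z

walkVerts : ∀ {n} {G : Graph n} {x z} → Walk G x z → List (Fin n)
walkVerts {x = x} [] = x ∷ []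
walkVerts {x = x} (step i j p) = x ∷ walkVerts p

walkEdges : ∀ {n} {G : Graph n} {x z} → Walk G x z → List (Edge n)
walkEdges [] = []
walkEdges {G = G} (step i j p) = edgeAt G i ∷ walkEdges p

Path : ∀ {n} → Graph n → Fin n → Fin n → Set
Path G w u = Σ (Walk G w u) λ p → Unique (walkVerts p)

pathGcd : ∀ {n} (G : Graph n) (w u : Fin n) → Path G w u → ℕ
pathGcd G w u p = gcdList (map weight (walkEdges (proj₁ p)))

IsLcmOf : {P : Set} → (P → ℕ) → ℕ → Set
IsLcmOf {P} f L = (∀ p → f p ∣ L) × (∀ d → (∀ p → f p ∣ d) → L ∣ d)

-- Both sides are least common multiples of finitely many numbers, so it suffices that the
-- paths of G and of G' have the same common multiples d. Mapping every collapsed edge to the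
-- new edge turns a path of G into a path of G' with the same vertices whose gcd is a multiple
-- of the old one (each weight of S divides their lcm). Conversely, a path of G' through the
-- new edge has gcd gcd(lcm_{s ∈ S} a_s, R), where R is the gcd of its other edges; replacing
-- the new edge by s ∈ S gives a path of G with gcd gcd(a_s, R), and gcd distributes over lcm.
module Submission where

open import Defs
open import Data.Nat using (ℕ; zero; suc; _*_; _≤_; _<_; s≤s; ≢-nonZero)
open import Data.Nat.Properties using (*-comm; ≤-<-connex; ≤-trans; n≤1+n)
open import Data.Nat.GCD
open import Data.Nat.LCM
open import Data.Nat.Divisibility
open import Data.Fin using (Fin; zero; suc; toℕ; _≟_)
open import Data.Fin.Properties using (pigeonhole)
open import Data.List using (List; []; _∷_; _++_; map; length; lookup; concatMap; allFin; filter)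
open import Data.List.Relation.Unary.All as All using (All; []; _∷_)
open import Data.List.Relation.Unary.All.Properties using (all-filter; map⁺)
open import Data.List.Relation.Unary.Any as Any using (here; there)
open import Data.List.Relation.Unary.Any.Properties using (lookup-index)
open import Data.List.Relation.Unary.Unique.Propositional using (Unique)
open import Data.List.Relation.Unary.AllPairs using (_∷_)
open import Data.List.Relation.Unary.Unique.DecPropositional using (unique?)
open import Data.List.Membership.Propositional using (_∈_; lose)
open import Data.List.Membership.Propositional.Properties
  using (∈-lookup; ∈-allFin; ∈-map⁺; ∈-++⁺ˡ; ∈-++⁺ʳ; ∈-++⁻; ∈-concatMap⁺; ∈-filter⁺)
open import Data.List.Relation.Binary.Permutation.Propositional using (_↭_; ↭-sym)
open import Data.List.Relation.Binary.Permutation.Propositional.Properties using (∈-resp-↭)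
open import Data.Product using (Σ; ∃; _×_; _,_; proj₁; proj₂)
open import Data.Sum using (_⊎_; inj₁; inj₂; swap)
open import Function using (id)
open import Function.Bundles using (_⇔_; mk⇔; Equivalence)
open import Function.Properties.Equivalence using () renaming (trans to ⇔-trans; sym to ⇔-sym)
open import Axiom.UniquenessOfIdentityProofs using (module Decidable⇒UIP)
open import Relation.Nullary using (Dec; yes; no; contradiction; Irrelevant)
open import Relation.Nullary.Decidable using (_×-dec_; dec-yes-irr)
open import Relation.Binary.PropositionalEquality

private
  variable
    n : ℕ
    a c d m : ℕ
    x y z w u : Fin n
    e s : Edge n
    E E′ : List (Edge n)

∣gcd*gcd : ∀ {k} p q r t → k ∣ p * r → k ∣ p * t → k ∣ q * r → k ∣ q * t →
           k ∣ gcd p q * gcd r t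
∣gcd*gcd {k} p q r t k∣pr k∣pt k∣qr k∣qt =
  subst (k ∣_) (sym gcd*gcd≡) (gcd-greatest (k∣·gcd p k∣pr k∣pt) (k∣·gcd q k∣qr k∣qt))
  where
  k∣·gcd : ∀ v → k ∣ v * r → k ∣ v * t → k ∣ v * gcd r t
  k∣·gcd v k∣vr k∣vt = subst (k ∣_) (sym (c*gcd[m,n]≡gcd[cm,cn] v r t)) (gcd-greatest k∣vr k∣vt)

  gcd*gcd≡ : gcd p q * gcd r t ≡ gcd (p * gcd r t) (q * gcd r t)
  gcd*gcd≡ = begin
    gcd p q * gcd r t               ≡⟨ *-comm (gcd p q) (gcd r t) ⟩
    gcd r t * gcd p q               ≡⟨ c*gcd[m,n]≡gcd[cm,cn] (gcd r t) p q ⟩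
    gcd (gcd r t * p) (gcd r t * q) ≡⟨ cong₂ gcd (*-comm (gcd r t) p) (*-comm (gcd r t) q) ⟩
    gcd (p * gcd r t) (q * gcd r t) ∎
    where open ≡-Reasoning

-- With t = gcd (gcd d a) (gcd d b): d·t divides gcd d a · gcd d b = t · lcm (gcd d a) (gcd d b).
∣lcm⇒∣lcm[gcd,gcd] : ∀ a b → d ∣ lcm a b → d ∣ lcm (gcd d a) (gcd d b)
∣lcm⇒∣lcm[gcd,gcd] {d} zero b _ =
  subst (λ g → d ∣ lcm g (gcd d b)) (sym (gcd-identityʳ d)) (m∣lcm[m,n] d (gcd d b))
∣lcm⇒∣lcm[gcd,gcd] {d} a@(suc _) b d∣lcm =
  *-cancelˡ-∣ t {{≢-nonZero t≢0}}
    (subst₂ _∣_ (*-comm d t) (sym (gcd*lcm a′ b′)) dt∣a′b′)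
  where
  a′ = gcd d a
  b′ = gcd d b
  t = gcd a′ b′
  t∣d = ∣-trans (gcd[m,n]∣m a′ b′) (gcd[m,n]∣m d a)
  t∣a = ∣-trans (gcd[m,n]∣m a′ b′) (gcd[m,n]∣n d a)
  t∣b = ∣-trans (gcd[m,n]∣n a′ b′) (gcd[m,n]∣n d b)

  d·gcd∣ab : d * gcd a b ∣ a * b
  d·gcd∣ab = subst (d * gcd a b ∣_) (trans (*-comm (lcm a b) (gcd a b)) (gcd*lcm a b))
               (*-monoˡ-∣ (gcd a b) d∣lcm)

  dt∣a′b′ : d * t ∣ a′ * b′
  dt∣a′b′ = ∣gcd*gcd d a d b (*-monoʳ-∣ d t∣d) (*-monoʳ-∣ d t∣b)
              (subst (d * t ∣_) (*-comm d a) (*-monoʳ-∣ d t∣a))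
              (∣-trans (*-monoʳ-∣ d (gcd-greatest t∣a t∣b)) d·gcd∣ab)

  t≢0 : t ≢ 0
  t≢0 t≡0 = contradiction (gcd[m,n]≡0⇒n≡0 d (gcd[m,n]≡0⇒m≡0 t≡0)) λ ()

gcd[lcm[a,b],c]∣lcm[gcd[a,c],gcd[b,c]] : ∀ a b c → gcd (lcm a b) c ∣ lcm (gcd a c) (gcd b c)
gcd[lcm[a,b],c]∣lcm[gcd[a,c],gcd[b,c]] a b c =
  ∣-trans (∣lcm⇒∣lcm[gcd,gcd] a b (gcd[m,n]∣m (lcm a b) c))
          (lcm-least (∣-trans (gcd[g,v]∣gcd[v,c] a) (m∣lcm[m,n] (gcd a c) (gcd b c)))
                     (∣-trans (gcd[g,v]∣gcd[v,c] b) (n∣lcm[m,n] (gcd a c) (gcd b c))))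
  where
  g = gcd (lcm a b) c
  gcd[g,v]∣gcd[v,c] : ∀ v → gcd g v ∣ gcd v c
  gcd[g,v]∣gcd[v,c] v = gcd-greatest (gcd[m,n]∣n g v)
                          (∣-trans (gcd[m,n]∣m g v) (gcd[m,n]∣n (lcm a b) c))

gcd[lcmList,c]∣ : ∀ as → All (λ a → gcd a c ∣ m) as → gcd (lcmList as) c ∣ m
gcd[lcmList,c]∣ {c} {m} [] [] = subst (_∣ m) (sym (gcd-zeroˡ c)) (1∣ m)
gcd[lcmList,c]∣ {c} (a ∷ as) (a∣ ∷ as∣) =
  ∣-trans (gcd[lcm[a,b],c]∣lcm[gcd[a,c],gcd[b,c]] a (lcmList as) c)
          (lcm-least a∣ (gcd[lcmList,c]∣ as as∣))

∈⇒∣lcmList : ∀ {as} → a ∈ as → a ∣ lcmList as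
∈⇒∣lcmList {as = a ∷ as} (here refl) = m∣lcm[m,n] a (lcmList as)
∈⇒∣lcmList {as = a ∷ as} (there a∈as) = ∣-trans (∈⇒∣lcmList a∈as) (n∣lcm[m,n] a (lcmList as))

lcmList-least : ∀ {as} → All (_∣ m) as → lcmList as ∣ m
lcmList-least [] = 1∣ _
lcmList-least (a∣ ∷ as∣) = lcm-least a∣ (lcmList-least as∣)

CommonMultiple : {P : Set} → (P → ℕ) → ℕ → Set
CommonMultiple f d = ∀ p → f p ∣ d

lcmList-IsLcmOf : {P : Set} {f : P → ℕ} (xs : List ℕ) →
                  (∀ p → f p ∈ xs) → All (λ v → ∃ λ p → f p ≡ v) xs → IsLcmOf f (lcmList xs)
lcmList-IsLcmOf xs complete sound =
  (λ p → ∈⇒∣lcmList (complete p)) ,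
  (λ d f∣d → lcmList-least (All.map (λ (p , fp≡v) → subst (_∣ d) fp≡v (f∣d p)) sound))

IsLcmOf-resp : {P Q : Set} {f : P → ℕ} {g : Q → ℕ} →
               (∀ d → CommonMultiple f d ⇔ CommonMultiple g d) → IsLcmOf f a → IsLcmOf g a
IsLcmOf-resp same (f∣a , a-least) =
  Equivalence.to (same _) f∣a , λ d g∣d → a-least d (Equivalence.from (same d) g∣d)

Unique⇒lookup-injective : ∀ {xs : List (Fin n)} → Unique xs → (i j : Fin (length xs)) →
                          toℕ i < toℕ j → lookup xs i ≢ lookup xs j
Unique⇒lookup-injective (x∉ ∷ _) zero (suc j) _ = All.lookup x∉ (∈-lookup j)
Unique⇒lookup-injective (_ ∷ uxs) (suc i) (suc j) (s≤s i<j) = Unique⇒lookup-injective uxs i j i<j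

Unique⇒length≤ : ∀ {xs : List (Fin n)} → Unique xs → length xs ≤ n
Unique⇒length≤ {n} {xs} uxs with ≤-<-connex (length xs) n
... | inj₁ ≤n = ≤n
... | inj₂ >n with i , j , i<j , same ← pigeonhole >n (lookup xs) =
  contradiction same (Unique⇒lookup-injective uxs i j i<j)

-- Finitely many paths: the lcm of their gcds exists

decList : {A : Set} → Dec A → List A
decList (yes a) = a ∷ []
decList (no _) = []

∈-decList : {A : Set} → Irrelevant A → (a? : Dec A) (a : A) → a ∈ decList a?
∈-decList irr a? a rewrite dec-yes-irr a? irr a = here refl

≡×≡-irrelevant : {p q r t : Fin n} → Irrelevant (p ≡ q × r ≡ t)
≡×≡-irrelevant (p≡q , r≡t) (p≡q′ , r≡t′) = cong₂ _,_ (≡-irrelevant p≡q p≡q′) (≡-irrelevant r≡t r≡t′)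
  where open Decidable⇒UIP _≟_ using (≡-irrelevant)

ends? : (e : Edge n) (x y : Fin n) → Dec (end₁ e ≡ x × end₂ e ≡ y)
ends? e x y = (end₁ e ≟ x) ×-dec (end₂ e ≟ y)

joinings : (e : Edge n) (x y : Fin n) → List (Joins e x y)
joinings e x y = map inj₁ (decList (ends? e x y)) ++ map inj₂ (decList (ends? e y x))

∈-joinings : (j : Joins e x y) → j ∈ joinings e x y
∈-joinings {e = e} {x} {y} (inj₁ j) = ∈-++⁺ˡ (∈-map⁺ inj₁ (∈-decList ≡×≡-irrelevant (ends? e x y) j))
∈-joinings {e = e} {x} {y} (inj₂ j) =
  ∈-++⁺ʳ (map inj₁ (decList (ends? e x y))) (∈-map⁺ inj₂ (∈-decList ≡×≡-irrelevant (ends? e y x) j))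

module _ (G : Graph n) where

  walkLength : Walk G x z → ℕ
  walkLength [] = 0
  walkLength (step _ _ p) = suc (walkLength p)

  length-walkVerts : (p : Walk G x z) → length (walkVerts p) ≡ suc (walkLength p)
  length-walkVerts [] = refl
  length-walkVerts (step _ _ p) = cong suc (length-walkVerts p)

  emptyWalks : (x z : Fin n) → List (Walk G x z)
  emptyWalks x z with x ≟ z
  ... | yes refl = [] ∷ []
  ... | no _ = []

  walksUpTo : ℕ → (x z : Fin n) → List (Walk G x z)
  walksUpTo zero x z = emptyWalks x z
  walksUpTo (suc k) x z = emptyWalks x z ++
    concatMap (λ i → concatMap (λ y → concatMap (λ j → map (step i j) (walksUpTo k y z))
                                                (joinings (edgeAt G i) x y))
                               (allFin n))
              (allFin (length (edges G)))

  ∈-emptyWalks : [] ∈ emptyWalks x x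
  ∈-emptyWalks {x} with x ≟ x
  ... | yes refl = here refl
  ... | no x≢x = contradiction refl x≢x

  ∈-walksUpTo : ∀ {k} (p : Walk G x z) → walkLength p ≤ k → p ∈ walksUpTo k x z
  ∈-walksUpTo {k = zero} [] _ = ∈-emptyWalks
  ∈-walksUpTo {k = suc k} [] _ = ∈-++⁺ˡ ∈-emptyWalks
  ∈-walksUpTo {k = suc k} (step {y = y} i j p) (s≤s ℓ≤k) =
    ∈-++⁺ʳ (emptyWalks _ _)
      (∈-concatMap⁺ _ (lose (∈-allFin i) (∈-concatMap⁺ _ (lose (∈-allFin y)
        (∈-concatMap⁺ _ (lose (∈-joinings {e = edgeAt G i} j)
          (∈-map⁺ (step i j) (∈-walksUpTo p ℓ≤k))))))))

  walkLength≤ : (p : Path G w u) → walkLength (proj₁ p) ≤ n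
  walkLength≤ (p , up) =
    ≤-trans (n≤1+n _) (subst (_≤ n) (length-walkVerts p) (Unique⇒length≤ up))

  pathGcd-lcm : (w u : Fin n) → Σ ℕ (IsLcmOf (pathGcd G w u))
  pathGcd-lcm w u = lcmList (map walkGcd paths) , lcmList-IsLcmOf _ complete sound
    where
    walkGcd : Walk G w u → ℕ
    walkGcd p = gcdList (map weight (walkEdges p))

    paths : List (Walk G w u)
    paths = filter (λ p → unique? _≟_ (walkVerts p)) (walksUpTo n w u)

    complete : ∀ p → pathGcd G w u p ∈ map walkGcd paths
    complete (p , up) = ∈-map⁺ walkGcd (∈-filter⁺ _ (∈-walksUpTo p (walkLength≤ (p , up))) up)

    sound : All (λ v → ∃ λ p → pathGcd G w u p ≡ v) (map walkGcd paths)
    sound = map⁺ (All.map (λ {p} up → (p , up) , refl) (all-filter _ (walksUpTo n w u)))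

-- Unlike Walk G, which picks edges by their index in edges G, a walk along E is invariant
-- under permutations of E.
data WalkIn (E : List (Edge n)) : Fin n → Fin n → Set where
  [] : WalkIn E x x
  step : e ∈ E → Joins e x y → WalkIn E y z → WalkIn E x z

verts : {E : List (Edge n)} → WalkIn E x z → List (Fin n)
verts {x = x} [] = x ∷ []
verts {x = x} (step _ _ p) = x ∷ verts p

Weighting : List (Edge n) → Set
Weighting E = ∀ {e} → e ∈ E → ℕ

edgeWeight : Weighting E
edgeWeight {e = e} _ = weight e

gcdAlong : Weighting E → WalkIn E x z → ℕ
gcdAlong ω [] = 0
gcdAlong ω (step e∈E _ p) = gcd (ω e∈E) (gcdAlong ω p)

gcdAlong-cong : {ω ω′ : Weighting E} → (∀ {e} (e∈E : e ∈ E) → ω e∈E ≡ ω′ e∈E) →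
                (p : WalkIn E x z) → gcdAlong ω p ≡ gcdAlong ω′ p
gcdAlong-cong ω≡ω′ [] = refl
gcdAlong-cong ω≡ω′ (step e∈E _ p) = cong₂ gcd (ω≡ω′ e∈E) (gcdAlong-cong ω≡ω′ p)

gcdAlong-mono : {ω ω′ : Weighting E} → (∀ {e} (e∈E : e ∈ E) → ω e∈E ∣ ω′ e∈E) →
                (p : WalkIn E x z) → gcdAlong ω p ∣ gcdAlong ω′ p
gcdAlong-mono ω∣ω′ [] = ∣-refl
gcdAlong-mono {ω = ω} ω∣ω′ (step e∈E _ p) =
  gcd-greatest (∣-trans (gcd[m,n]∣m (ω e∈E) (gcdAlong ω p)) (ω∣ω′ e∈E))
               (∣-trans (gcd[m,n]∣n (ω e∈E) (gcdAlong ω p)) (gcdAlong-mono ω∣ω′ p))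

PathMultiple : List (Edge n) → Fin n → Fin n → ℕ → Set
PathMultiple E w u d = (p : WalkIn E w u) → Unique (verts p) → gcdAlong edgeWeight p ∣ d

module _ (G : Graph n) where

  toWalkIn : Walk G x z → WalkIn (edges G) x z
  toWalkIn [] = []
  toWalkIn (step i j p) = step (∈-lookup i) j (toWalkIn p)

  verts-toWalkIn : (p : Walk G x z) → verts (toWalkIn p) ≡ walkVerts p
  verts-toWalkIn [] = refl
  verts-toWalkIn {x} (step _ _ p) = cong (x ∷_) (verts-toWalkIn p)

  gcdAlong-toWalkIn : (p : Walk G x z) →
                      gcdAlong edgeWeight (toWalkIn p) ≡ gcdList (map weight (walkEdges p))
  gcdAlong-toWalkIn [] = refl
  gcdAlong-toWalkIn (step i _ p) = cong (gcd (weight (edgeAt G i))) (gcdAlong-toWalkIn p)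

  fromWalkIn : WalkIn (edges G) x z → Walk G x z
  fromWalkIn [] = []
  fromWalkIn {x} (step {y = y} e∈E j p) =
    step (Any.index e∈E) (subst (λ e → Joins e x y) (lookup-index e∈E) j) (fromWalkIn p)

  walkVerts-fromWalkIn : (p : WalkIn (edges G) x z) → walkVerts (fromWalkIn p) ≡ verts p
  walkVerts-fromWalkIn [] = refl
  walkVerts-fromWalkIn {x} (step _ _ p) = cong (x ∷_) (walkVerts-fromWalkIn p)

  gcdAlong-fromWalkIn : (p : WalkIn (edges G) x z) →
                        gcdList (map weight (walkEdges (fromWalkIn p))) ≡ gcdAlong edgeWeight p
  gcdAlong-fromWalkIn [] = refl
  gcdAlong-fromWalkIn (step e∈E _ p) =
    cong₂ gcd (cong weight (sym (lookup-index e∈E))) (gcdAlong-fromWalkIn p)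

  CommonMultiple⇔PathMultiple : CommonMultiple (pathGcd G w u) d ⇔ PathMultiple (edges G) w u d
  CommonMultiple⇔PathMultiple {d = d} = mk⇔
    (λ cm p up → subst (_∣ d) (gcdAlong-fromWalkIn p)
                   (cm (fromWalkIn p , subst Unique (sym (walkVerts-fromWalkIn p)) up)))
    (λ pm (p , up) → subst (_∣ d) (gcdAlong-toWalkIn p)
                       (pm (toWalkIn p) (subst Unique (sym (verts-toWalkIn p)) up)))

record EdgeImage (E′ : List (Edge n)) (e : Edge n) : Set where
  field
    edge : Edge n
    edge∈ : edge ∈ E′
    joins : ∀ {a b : Fin n} → Joins e a b → Joins edge a b

open EdgeImage

EdgeMap : List (Edge n) → List (Edge n) → Set
EdgeMap E E′ = ∀ {e} → e ∈ E → EdgeImage E′ e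

mapWalk : EdgeMap E E′ → WalkIn E x z → WalkIn E′ x z
mapWalk σ [] = []
mapWalk σ (step e∈E j p) = step (edge∈ (σ e∈E)) (joins (σ e∈E) j) (mapWalk σ p)

verts-mapWalk : (σ : EdgeMap E E′) (p : WalkIn E x z) → verts (mapWalk σ p) ≡ verts p
verts-mapWalk σ [] = refl
verts-mapWalk {x = x} σ (step _ _ p) = cong (x ∷_) (verts-mapWalk σ p)

gcdAlong-mapWalk : (σ : EdgeMap E E′) (p : WalkIn E x z) →
                   gcdAlong edgeWeight (mapWalk σ p) ≡ gcdAlong (λ e∈E → weight (edge (σ e∈E))) p
gcdAlong-mapWalk σ [] = refl
gcdAlong-mapWalk σ (step e∈E _ p) = cong (gcd (weight (edge (σ e∈E)))) (gcdAlong-mapWalk σ p)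

PathMultiple-mapWalk : (σ : EdgeMap E E′) → PathMultiple E′ w u d →
                       (p : WalkIn E w u) → Unique (verts p) →
                       gcdAlong (λ e∈E → weight (edge (σ e∈E))) p ∣ d
PathMultiple-mapWalk {d = d} σ pm p up =
  subst (_∣ d) (gcdAlong-mapWalk σ p) (pm (mapWalk σ p) (subst Unique (sym (verts-mapWalk σ p)) up))

PathMultiple-pullback : (σ : EdgeMap E E′) → (∀ {e} (e∈E : e ∈ E) → weight e ∣ weight (edge (σ e∈E))) →
                        PathMultiple E′ w u d → PathMultiple E w u d
PathMultiple-pullback σ weight∣ pm p up = ∣-trans (gcdAlong-mono weight∣ p) (PathMultiple-mapWalk σ pm p up)

↭-edgeMap : E ↭ E′ → EdgeMap E E′
↭-edgeMap π {e} e∈E = record { edge = e ; edge∈ = ∈-resp-↭ π e∈E ; joins = id }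

PathMultiple-resp-↭ : E ↭ E′ → PathMultiple E w u d ⇔ PathMultiple E′ w u d
PathMultiple-resp-↭ π = mk⇔ (PathMultiple-pullback (↭-edgeMap (↭-sym π)) (λ _ → ∣-refl))
                            (PathMultiple-pullback (↭-edgeMap π) (λ _ → ∣-refl))

Joins-transport : ∀ {f : Edge n} {a b} → Joins e x y → Joins f x y → Joins e a b → Joins f a b
Joins-transport {e = _ , _ , _} (inj₁ (refl , refl)) jf (inj₁ (refl , refl)) = jf
Joins-transport {e = _ , _ , _} (inj₁ (refl , refl)) jf (inj₂ (refl , refl)) = swap jf
Joins-transport {e = _ , _ , _} (inj₂ (refl , refl)) jf (inj₁ (refl , refl)) = swap jf
Joins-transport {e = _ , _ , _} (inj₂ (refl , refl)) jf (inj₂ (refl , refl)) = jf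

replaceHead : ∀ {e₀ : Edge n} → ℕ → Weighting (e₀ ∷ E)
replaceHead v (here _) = v
replaceHead v {e} (there _) = weight e

gcdAlong-replaceHead : ∀ {e₀ : Edge n} (p : WalkIn (e₀ ∷ E) x z) →
  (∃ λ R → ∀ v → gcdAlong (replaceHead v) p ≡ gcd v R) ⊎
  (∀ v v′ → gcdAlong (replaceHead v) p ≡ gcdAlong (replaceHead v′) p)
gcdAlong-replaceHead [] = inj₂ λ _ _ → refl
gcdAlong-replaceHead (step (here _) _ p) with gcdAlong-replaceHead p
... | inj₁ (R , ≡gcd) = inj₁ (R , λ v → trans (cong (gcd v) (≡gcd v)) (gcd[v,gcd[v,R]]≡gcd[v,R] v R))
  where
  gcd[v,gcd[v,R]]≡gcd[v,R] : ∀ v R → gcd v (gcd v R) ≡ gcd v R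
  gcd[v,gcd[v,R]]≡gcd[v,R] v R =
    ∣-antisym (gcd[m,n]∣n v (gcd v R)) (gcd-greatest (gcd[m,n]∣m v R) ∣-refl)
... | inj₂ constant = inj₁ (gcdAlong (replaceHead 0) p , λ v → cong (gcd v) (constant v 0))
gcdAlong-replaceHead (step {e = e} (there _) _ p) with gcdAlong-replaceHead p
... | inj₁ (R , ≡gcd) = inj₁ (gcd (weight e) R , λ v → trans (cong (gcd (weight e)) (≡gcd v)) (gcd-swap v))
  where
  gcd-swap : ∀ v → gcd (weight e) (gcd v R) ≡ gcd v (gcd (weight e) R)
  gcd-swap v = begin
    gcd (weight e) (gcd v R) ≡⟨ gcd-assoc (weight e) v R ⟨
    gcd (gcd (weight e) v) R ≡⟨ cong (λ g → gcd g R) (gcd-comm (weight e) v) ⟩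
    gcd (gcd v (weight e)) R ≡⟨ gcd-assoc v (weight e) R ⟩
    gcd v (gcd (weight e) R) ∎
    where open ≡-Reasoning
... | inj₂ constant = inj₂ λ v v′ → cong (gcd (weight e)) (constant v v′)

module Collapse {x y : Fin n} (S rest : List (Edge n)) (S-joins : All (λ e → Joins e x y) S) where

  C : ℕ
  C = lcmList (map weight S)

  collapsed : Edge n
  collapsed = x , y , C

  collapse : EdgeMap (S ++ rest) (collapsed ∷ rest)
  collapse {e} e∈ with ∈-++⁻ S e∈
  ... | inj₁ e∈S = record
    { edge = collapsed ; edge∈ = here refl
    ; joins = Joins-transport {e = e} {f = collapsed} (All.lookup S-joins e∈S) (inj₁ (refl , refl)) }
  ... | inj₂ e∈rest = record { edge = _ ; edge∈ = there e∈rest ; joins = id }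

  weight∣collapse : (e∈ : e ∈ S ++ rest) → weight e ∣ weight (edge (collapse e∈))
  weight∣collapse e∈ with ∈-++⁻ S e∈
  ... | inj₁ e∈S = ∈⇒∣lcmList (∈-map⁺ weight e∈S)
  ... | inj₂ _ = ∣-refl

  expand : s ∈ S → EdgeMap (collapsed ∷ rest) (S ++ rest)
  expand {s = s} s∈S (here refl) = record
    { edge = s ; edge∈ = ∈-++⁺ˡ s∈S
    ; joins = Joins-transport {e = collapsed} {f = s} (inj₁ (refl , refl)) (All.lookup S-joins s∈S) }
  expand s∈S (there e∈rest) = record { edge = _ ; edge∈ = ∈-++⁺ʳ S e∈rest ; joins = id }

  weight-expand : (s∈S : s ∈ S) (e∈ : e ∈ collapsed ∷ rest) →
                  weight (edge (expand s∈S e∈)) ≡ replaceHead (weight s) e∈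
  weight-expand s∈S (here refl) = refl
  weight-expand s∈S (there _) = refl

  edgeWeight≡replaceHead : (e∈ : e ∈ collapsed ∷ rest) → edgeWeight e∈ ≡ replaceHead C e∈
  edgeWeight≡replaceHead (here refl) = refl
  edgeWeight≡replaceHead (there _) = refl

  expand-∣ : PathMultiple (S ++ rest) w u d → s ∈ S → (q : WalkIn (collapsed ∷ rest) w u) →
             Unique (verts q) → gcdAlong (replaceHead (weight s)) q ∣ d
  expand-∣ {d = d} pm s∈S q uq =
    subst (_∣ d) (gcdAlong-cong (weight-expand s∈S) q) (PathMultiple-mapWalk (expand s∈S) pm q uq)

  expand-PathMultiple : s ∈ S → PathMultiple (S ++ rest) w u d → PathMultiple (collapsed ∷ rest) w u d
  expand-PathMultiple {d = d} s₀∈S pm q uq with gcdAlong-replaceHead q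
  ... | inj₁ (R , ≡gcd) =
    subst (_∣ d) (sym (trans (gcdAlong-cong edgeWeight≡replaceHead q) (≡gcd C)))
      (gcd[lcmList,c]∣ (map weight S)
        (map⁺ (All.tabulate λ s∈S → subst (_∣ d) (≡gcd _) (expand-∣ pm s∈S q uq))))
  ... | inj₂ constant =
    subst (_∣ d) (sym (trans (gcdAlong-cong edgeWeight≡replaceHead q) (constant C _)))
      (expand-∣ pm s₀∈S q uq)

  PathMultiple-collapse : s ∈ S → PathMultiple (S ++ rest) w u d ⇔ PathMultiple (collapsed ∷ rest) w u d
  PathMultiple-collapse s∈S =
    mk⇔ (expand-PathMultiple s∈S) (PathMultiple-pullback collapse weight∣collapse)

lemma5p2 : (n : ℕ) (G G' : Graph n) → EdgeCollapse G G' → (w u : Fin n) → w ≢ u →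
    Σ ℕ (λ L → IsLcmOf (pathGcd G w u) L × IsLcmOf (pathGcd G' w u) L)
lemma5p2 n G G' (x , y , [] , rest , _ , () , _) w u _
lemma5p2 n G G' (x , y , S@(_ ∷ _) , rest , G↭ , _ , S-joins , G'↭) w u _ =
  L , L-lcm , IsLcmOf-resp sameCommonMultiples L-lcm
  where
  open Collapse S rest S-joins
  L = proj₁ (pathGcd-lcm G w u)
  L-lcm = proj₂ (pathGcd-lcm G w u)

  sameCommonMultiples : ∀ d → CommonMultiple (pathGcd G w u) d ⇔ CommonMultiple (pathGcd G' w u) d
  sameCommonMultiples d =
    ⇔-trans (CommonMultiple⇔PathMultiple G)
    (⇔-trans (PathMultiple-resp-↭ G↭)
    (⇔-trans (PathMultiple-collapse (here refl))
    (⇔-trans (PathMultiple-resp-↭ (↭-sym G'↭))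
             (⇔-sym (CommonMultiple⇔PathMultiple G')))))
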